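{- Let $\delta\geq 0$ be an integer and $\Gamma=\mathbb{Z}_{2^{2\delta+1}}\oplus \mathbb{Z}_{2^{2\delta+3}}$. Then there exists a $\Gamma$-magic square $\mathrm{MS}_{\Gamma}(2^{2\delta+2})$ of side $2^{2\delta+2}$.
   Context: For an Abelian group $(\Gamma,+)$ of order $n^2$, a $\Gamma$-magic square $\mathrm{MS}_{\Gamma}(n)$ (of side $n$) is an $n\times n$ array whose entries are all the elements of $\Gamma$ (each element appearing exactly once) such that all row sums, all column sums, the sum along the main diagonal and the sum along the backward main diagonal are equal to the same element $\mu\in\Gamma$. $\mathbb{Z}_r$ denotes the cyclic group of order $r$. -}

module Defs where

open import Data.Nat using (ℕ; zero; suc; _+_; _*_; _^_; NonZero)
open import Data.Nat.DivMod using (_mod_)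
open import Data.Fin using (Fin; toℕ; zero; suc)
open import Data.Product using (_×_; _,_; Σ; proj₁; proj₂)
open import Relation.Binary.PropositionalEquality using (_≡_)
open import Function.Definitions using (Bijective)

addℤ : (r : ℕ) .{{_ : NonZero r}} → Fin r → Fin r → Fin r
addℤ r x y = (toℕ x + toℕ y) mod r

Zsum : ℕ → ℕ → Set
Zsum a b = Fin a × Fin b

addZsum : (a b : ℕ) .{{_ : NonZero a}} .{{_ : NonZero b}} → Zsum a b → Zsum a b → Zsum a b
addZsum a b (x₁ , y₁) (x₂ , y₂) = addℤ a x₁ x₂ , addℤ b y₁ y₂

zeroZsum : (a b : ℕ) .{{_ : NonZero a}} .{{_ : NonZero b}} → Zsum a b
zeroZsum a b = (0 mod a) , (0 mod b)

sumZ : (a b : ℕ) .{{_ : NonZero a}} .{{_ : NonZero b}} → (n : ℕ) → (Fin n → Zsum a b) → Zsum a b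
sumZ a b zero    f = zeroZsum a b
sumZ a b (suc n) f = addZsum a b (f zero) (sumZ a b n (λ i → f (suc i)))

opp : ∀ {n} → Fin n → Fin n
opp = Data.Fin.opposite

-- A (Z_a ⊕ Z_b)-magic square of side n: an n×n array containing every element
-- of Z_a ⊕ Z_b exactly once (bijection from cells to the group; this forces
-- a*b = n^2), with all row sums, column sums, and both main diagonal sums
-- equal to a common element μ.
record MagicSquare (a b : ℕ) .{{_ : NonZero a}} .{{_ : NonZero b}} (n : ℕ) : Set where
  field
    entry     : Fin n × Fin n → Zsum a b
    bijective : Bijective _≡_ _≡_ entry
    μ         : Zsum a b
    rows      : ∀ i → sumZ a b n (λ j → entry (i , j)) ≡ μ
    cols      : ∀ j → sumZ a b n (λ i → entry (i , j)) ≡ μ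
    diag      : sumZ a b n (λ i → entry (i , i)) ≡ μ
    antidiag  : sumZ a b n (λ i → entry (i , opp i)) ≡ μ

-- Write N = 16q, m = 8q and M = 32q, so that N = 2m and M = 2N. The cell (i, j), 0 ≤ i, j < N,
-- receives (⌊i/2⌋, 2h + e) ∈ Z_m ⊕ Z_M, where h = i + j + m·[i < 2]·[j even] and
-- e = (i + b(i + j)) mod 2, with b(x) = ⌊x/4⌋ mod 2 the bit of weight 4 of x.
-- As 8 divides m and N, b(h mod N) = b(i + j): the second coordinate yields h mod N and e, hence
-- the parity of i, which with ⌊i/2⌋ gives i; the parity of h + i is that of j, which fixes the
-- correction m·[i < 2]·[j even] and then j ≡ h − i − m·[i < 2]·[j even] (mod N).
-- Along every row, column and diagonal the bits e are balanced on each 8 consecutive cells, so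
-- they add up to m, while the h add up to m modulo N; so every line sums to (0, m + N).
-- The square of side 4 (δ = 0) is explicit; for δ ≥ 1 take q = 4^(δ-1).

module Submission where

open import Defs
open import Data.Nat using (ℕ; _+_; _*_; _^_)
open import Data.Nat.Properties using (m^n≢0)

open import Algebra.Properties.CommutativeSemigroup using (interchange)
open import Data.Fin using (Fin; toℕ; fromℕ<; #_) renaming (zero to fzero; suc to fsuc)
open import Data.Fin.Properties using (toℕ-fromℕ<; toℕ-injective; toℕ<n; opposite-prop; all?)
  renaming (_≟_ to _≟ᶠ_)
open import Data.Nat using (zero; suc; _∸_; _≤_; _<_; z≤n; s≤s; z<s; s<s; NonZero; ⌊_/2⌋)
open import Data.Nat.DivMod
open import Data.Nat.Divisibility using (_∣_; divides)
open import Data.Nat.Properties hiding (_≟_)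
open import Data.Nat.Tactic.RingSolver using (solve-∀)
open import Data.Product using (_×_; _,_; proj₁; proj₂)
open import Data.Product.Properties using (≡-dec)
open import Data.Vec using (Vec; _∷_; []; lookup)
open import Function.Consequences.Propositional
  using (inverseᵇ⇒bijective; strictlyInverseˡ⇒inverseˡ; strictlyInverseʳ⇒inverseʳ)
open import Relation.Binary using (DecidableEquality)
open import Relation.Binary.PropositionalEquality
open import Relation.Nullary.Decidable using (from-yes)

∑ : ℕ → (ℕ → ℕ) → ℕ
∑ zero    f = 0
∑ (suc n) f = f 0 + ∑ n (λ k → f (suc k))

syntax ∑ n (λ k → e) = ∑[ k < n ] e

∑-cong : ∀ n {f g : ℕ → ℕ} → (∀ k → k < n → f k ≡ g k) → ∑ n f ≡ ∑ n g
∑-cong zero    f≗g = refl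
∑-cong (suc n) f≗g = cong₂ _+_ (f≗g 0 z<s) (∑-cong n (λ k k<n → f≗g (suc k) (s<s k<n)))

∑-+ : ∀ n (f g : ℕ → ℕ) → ∑[ k < n ] (f k + g k) ≡ ∑ n f + ∑ n g
∑-+ zero    f g = refl
∑-+ (suc n) f g rewrite ∑-+ n (λ k → f (suc k)) (λ k → g (suc k)) =
  interchange +-commutativeSemigroup (f 0) (g 0) _ _

∑-*ˡ : ∀ n c (f : ℕ → ℕ) → ∑[ k < n ] (c * f k) ≡ c * ∑ n f
∑-*ˡ zero    c f = sym (*-zeroʳ c)
∑-*ˡ (suc n) c f rewrite ∑-*ˡ n c (λ k → f (suc k)) = sym (*-distribˡ-+ c (f 0) _)

∑-const : ∀ n c → ∑ n (λ _ → c) ≡ n * c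
∑-const zero    c = refl
∑-const (suc n) c = cong (c +_) (∑-const n c)

∑-+-split : ∀ a b (f : ℕ → ℕ) → ∑ (a + b) f ≡ ∑ a f + ∑[ k < b ] f (a + k)
∑-+-split zero    b f = refl
∑-+-split (suc a) b f rewrite ∑-+-split a b (λ k → f (suc k)) = sym (+-assoc (f 0) _ _)

∑-periodic : ∀ p n (f : ℕ → ℕ) → (∀ x → f (p + x) ≡ f x) → ∑ (n * p) f ≡ n * ∑ p f
∑-periodic p zero    f f-per = refl
∑-periodic p (suc n) f f-per = begin
  ∑ (p + n * p) f                      ≡⟨ ∑-+-split p (n * p) f ⟩
  ∑ p f + ∑[ k < n * p ] f (p + k)    ≡⟨ cong (∑ p f +_) (∑-cong (n * p) (λ k _ → f-per k)) ⟩
  ∑ p f + ∑ (n * p) f                  ≡⟨ cong (∑ p f +_) (∑-periodic p n f f-per) ⟩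
  ∑ p f + n * ∑ p f                    ∎
  where open ≡-Reasoning

2*∑-id+n≡n*n : ∀ n → 2 * ∑[ k < n ] k + n ≡ n * n
2*∑-id+n≡n*n zero    = refl
2*∑-id+n≡n*n (suc n) = begin
  2 * ∑[ k < n ] suc k + suc n           ≡⟨ cong (λ s → 2 * s + suc n) (∑-+ n (λ _ → 1) (λ k → k)) ⟩
  2 * (∑ n (λ _ → 1) + S) + suc n        ≡⟨ cong (λ s → 2 * (s + S) + suc n) (∑-const n 1) ⟩
  2 * (n * 1 + S) + suc n                ≡⟨ regroup n S ⟩
  (2 * S + n) + (2 * n + 1)              ≡⟨ cong (_+ (2 * n + 1)) (2*∑-id+n≡n*n n) ⟩
  n * n + (2 * n + 1)                    ≡⟨ square-suc n ⟩
  suc n * suc n                          ∎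
  where
  open ≡-Reasoning
  S = ∑[ k < n ] k
  regroup : ∀ n S → 2 * (n * 1 + S) + suc n ≡ (2 * S + n) + (2 * n + 1)
  regroup = solve-∀
  square-suc : ∀ n → n * n + (2 * n + 1) ≡ suc n * suc n
  square-suc = solve-∀

∑-⌊/2⌋+n≡n*n : ∀ n → ∑[ k < n * 2 ] ⌊ k /2⌋ + n ≡ n * n
∑-⌊/2⌋+n≡n*n zero    = refl
∑-⌊/2⌋+n≡n*n (suc n) = begin
  ∑[ k < n * 2 ] suc ⌊ k /2⌋ + suc n          ≡⟨ cong (_+ suc n) (∑-+ (n * 2) (λ _ → 1) (λ k → ⌊ k /2⌋)) ⟩
  ∑ (n * 2) (λ _ → 1) + S + suc n             ≡⟨ cong (λ s → s + S + suc n) (∑-const (n * 2) 1) ⟩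
  n * 2 * 1 + S + suc n                       ≡⟨ regroup n S ⟩
  (S + n) + (2 * n + 1)                       ≡⟨ cong (_+ (2 * n + 1)) (∑-⌊/2⌋+n≡n*n n) ⟩
  n * n + (2 * n + 1)                         ≡⟨ square-suc n ⟩
  suc n * suc n                               ∎
  where
  open ≡-Reasoning
  S = ∑[ k < n * 2 ] ⌊ k /2⌋
  regroup : ∀ n S → n * 2 * 1 + S + suc n ≡ (S + n) + (2 * n + 1)
  regroup = solve-∀
  square-suc : ∀ n → n * n + (2 * n + 1) ≡ suc n * suc n
  square-suc = solve-∀

toℕ-mod : ∀ x d .{{_ : NonZero d}} → toℕ (x mod d) ≡ x % d
toℕ-mod x d = toℕ-fromℕ< (m%n<n x d)

mod-cong : ∀ x y d .{{_ : NonZero d}} → x % d ≡ y % d → x mod d ≡ y mod d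
mod-cong x y d x≡y = toℕ-injective (begin
  toℕ (x mod d)   ≡⟨ toℕ-mod x d ⟩
  x % d           ≡⟨ x≡y ⟩
  y % d           ≡⟨ toℕ-mod y d ⟨
  toℕ (y mod d)   ∎)
  where open ≡-Reasoning

addℤ-mod : ∀ r .{{_ : NonZero r}} x y → addℤ r (x mod r) (y mod r) ≡ (x + y) mod r
addℤ-mod r x y = mod-cong (toℕ (x mod r) + toℕ (y mod r)) (x + y) r (begin
  (toℕ (x mod r) + toℕ (y mod r)) % r   ≡⟨ cong₂ (λ u v → (u + v) % r) (toℕ-mod x r) (toℕ-mod y r) ⟩
  (x % r + y % r) % r                   ≡⟨ %-distribˡ-+ x y r ⟨
  (x + y) % r                           ∎)
  where open ≡-Reasoning

sumZ-cong : ∀ a b .{{_ : NonZero a}} .{{_ : NonZero b}} n {F G : Fin n → Zsum a b} →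
            (∀ k → F k ≡ G k) → sumZ a b n F ≡ sumZ a b n G
sumZ-cong a b zero    F≗G = refl
sumZ-cong a b (suc n) F≗G = cong₂ (addZsum a b) (F≗G fzero) (sumZ-cong a b n (λ k → F≗G (fsuc k)))

sumZ-mod : ∀ a b .{{_ : NonZero a}} .{{_ : NonZero b}} n (f g : ℕ → ℕ) →
           sumZ a b n (λ k → f (toℕ k) mod a , g (toℕ k) mod b) ≡ (∑ n f mod a , ∑ n g mod b)
sumZ-mod a b zero    f g = refl
sumZ-mod a b (suc n) f g
  rewrite sumZ-mod a b n (λ k → f (suc k)) (λ k → g (suc k)) =
  cong₂ _,_ (addℤ-mod a (f 0) _) (addℤ-mod b (g 0) _)

n%2≤1 : ∀ n → n % 2 ≤ 1
n%2≤1 n = ≤-pred (m%n<n n 2)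

2*⌊n/2⌋+n%2≡n : ∀ n → 2 * ⌊ n /2⌋ + n % 2 ≡ n
2*⌊n/2⌋+n%2≡n zero = refl
2*⌊n/2⌋+n%2≡n (suc zero) = refl
2*⌊n/2⌋+n%2≡n (suc (suc n)) = trans (shift ⌊ n /2⌋ (n % 2)) (cong (2 +_) (2*⌊n/2⌋+n%2≡n n))
  where
  shift : ∀ h r → 2 * suc h + r ≡ 2 + (2 * h + r)
  shift = solve-∀

⌊2m+n/2⌋≡m+⌊n/2⌋ : ∀ m n → ⌊ 2 * m + n /2⌋ ≡ m + ⌊ n /2⌋
⌊2m+n/2⌋≡m+⌊n/2⌋ zero    n = refl
⌊2m+n/2⌋≡m+⌊n/2⌋ (suc m) n =
  trans (cong ⌊_/2⌋ (shift m n)) (cong suc (⌊2m+n/2⌋≡m+⌊n/2⌋ m n))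
  where
  shift : ∀ m n → 2 * suc m + n ≡ 2 + (2 * m + n)
  shift = solve-∀

⌊2m+n/2⌋≡m : ∀ m {n} → n ≤ 1 → ⌊ 2 * m + n /2⌋ ≡ m
⌊2m+n/2⌋≡m m z≤n       = trans (⌊2m+n/2⌋≡m+⌊n/2⌋ m 0) (+-identityʳ m)
⌊2m+n/2⌋≡m m (s≤s z≤n) = trans (⌊2m+n/2⌋≡m+⌊n/2⌋ m 1) (+-identityʳ m)

2m+n<2o : ∀ {m n o} → m < o → n ≤ 1 → 2 * m + n < 2 * o
2m+n<2o {m} {n} {o} m<o n≤1 = begin-strict
  2 * m + n          ≤⟨ +-monoʳ-≤ (2 * m) n≤1 ⟩
  2 * m + 1          <⟨ n<1+n _ ⟩
  suc (2 * m + 1)    ≡⟨ 1+[2m+1]≡2[1+m] m ⟩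
  2 * suc m          ≤⟨ *-monoʳ-≤ 2 m<o ⟩
  2 * o              ∎
  where
  open ≤-Reasoning
  1+[2m+1]≡2[1+m] : ∀ m → suc (2 * m + 1) ≡ 2 * suc m
  1+[2m+1]≡2[1+m] = solve-∀

⌊n/2⌋<m : ∀ {n m} → n < 2 * m → ⌊ n /2⌋ < m
⌊n/2⌋<m {n} {m} n<2m = *-cancelˡ-< 2 ⌊ n /2⌋ m (begin-strict
  2 * ⌊ n /2⌋          ≤⟨ m≤m+n (2 * ⌊ n /2⌋) (n % 2) ⟩
  2 * ⌊ n /2⌋ + n % 2  ≡⟨ 2*⌊n/2⌋+n%2≡n n ⟩
  n                    <⟨ n<2m ⟩
  2 * m                ∎)
  where open ≤-Reasoning

[2m+n]%2≡n%2 : ∀ m n → (2 * m + n) % 2 ≡ n % 2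
[2m+n]%2≡n%2 m n = trans (cong (_% 2) (swap m n)) ([m+kn]%n≡m%n n m 2)
  where
  swap : ∀ m n → 2 * m + n ≡ n + m * 2
  swap = solve-∀

[[m+n]%2+n]%2≡m%2 : ∀ m n → ((m + n) % 2 + n) % 2 ≡ m % 2
[[m+n]%2+n]%2≡m%2 m n = begin
  ((m + n) % 2 + n) % 2   ≡⟨ %-distribˡ-+ ((m + n) % 2) n 2 ⟩
  ((m + n) % 2 % 2 + n % 2) % 2 ≡⟨ cong (λ x → (x + n % 2) % 2) (m%n%n≡m%n (m + n) 2) ⟩
  ((m + n) % 2 + n % 2) % 2 ≡⟨ %-distribˡ-+ (m + n) n 2 ⟨
  (m + n + n) % 2         ≡⟨ cong (_% 2) (regroup m n) ⟩
  (m + n * 2) % 2         ≡⟨ [m+kn]%n≡m%n m n 2 ⟩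
  m % 2                   ∎
  where
  open ≡-Reasoning
  regroup : ∀ m n → m + n + n ≡ m + n * 2
  regroup = solve-∀

[m%n+o]%n≡[m+o]%n : ∀ m o n .{{_ : NonZero n}} → (m % n + o) % n ≡ (m + o) % n
[m%n+o]%n≡[m+o]%n m o n = begin
  (m % n + o) % n             ≡⟨ %-distribˡ-+ (m % n) o n ⟩
  (m % n % n + o % n) % n     ≡⟨ cong (λ x → (x + o % n) % n) (m%n%n≡m%n m n) ⟩
  (m % n + o % n) % n         ≡⟨ %-distribˡ-+ m o n ⟨
  (m + o) % n                 ∎
  where open ≡-Reasoning

[m%n+o]%2≡[m+o]%2 : ∀ m n o .{{_ : NonZero n}} → 2 ∣ n → (m % n + o) % 2 ≡ (m + o) % 2
[m%n+o]%2≡[m+o]%2 m n o 2∣n = begin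
  (m % n + o) % 2             ≡⟨ %-distribˡ-+ (m % n) o 2 ⟩
  (m % n % 2 + o % 2) % 2     ≡⟨ cong (λ x → (x + o % 2) % 2) (m∣n⇒o%n%m≡o%m 2 n m 2∣n) ⟩
  (m % 2 + o % 2) % 2         ≡⟨ %-distribˡ-+ m o 2 ⟨
  (m + o) % 2                 ∎
  where open ≡-Reasoning

isEven : ℕ → ℕ
isEven x = 1 ∸ x % 2

below2 : ℕ → ℕ
below2 0 = 1
below2 1 = 1
below2 (suc (suc _)) = 0

corner : ℕ → ℕ → ℕ
corner i j = below2 i * isEven j

∑-below2 : ∀ n (g : ℕ → ℕ) → ∑[ i < 2 + n ] (below2 i * g i) ≡ g 0 + g 1
∑-below2 n g = cong₂ _+_ (*-identityˡ (g 0)) (begin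
  1 * g 1 + ∑[ i < n ] (0 * g (2 + i))  ≡⟨ cong₂ _+_ (*-identityˡ (g 1)) (∑-const n 0) ⟩
  g 1 + n * 0                          ≡⟨ cong (g 1 +_) (*-zeroʳ n) ⟩
  g 1 + 0                              ≡⟨ +-identityʳ (g 1) ⟩
  g 1                                  ∎)
  where open ≡-Reasoning

bit₂ : ℕ → ℕ
bit₂ x = x % 8 / 4

bit₂[m+n*8]≡bit₂m : ∀ m n → bit₂ (m + n * 8) ≡ bit₂ m
bit₂[m+n*8]≡bit₂m m n = cong (_/ 4) ([m+kn]%n≡m%n m n 8)

bit₂[m%n]≡bit₂m : ∀ m n .{{_ : NonZero n}} → 8 ∣ n → bit₂ (m % n) ≡ bit₂ m
bit₂[m%n]≡bit₂m m n 8∣n = cong (_/ 4) (m∣n⇒o%n%m≡o%m 8 n m 8∣n)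

lowBit : ℕ → ℕ → ℕ
lowBit i j = (i + bit₂ (i + j)) % 2

-- lowBit is definitionally 8-periodic in each argument, which justifies the last clauses.
∑-lowBit-row8 : ∀ i → ∑[ j < 8 ] lowBit i j ≡ 4
∑-lowBit-row8 0 = refl
∑-lowBit-row8 1 = refl
∑-lowBit-row8 2 = refl
∑-lowBit-row8 3 = refl
∑-lowBit-row8 4 = refl
∑-lowBit-row8 5 = refl
∑-lowBit-row8 6 = refl
∑-lowBit-row8 7 = refl
∑-lowBit-row8 (suc (suc (suc (suc (suc (suc (suc (suc i)))))))) = ∑-lowBit-row8 i

∑-lowBit-col8 : ∀ j → ∑[ i < 8 ] lowBit i j ≡ 4
∑-lowBit-col8 0 = refl
∑-lowBit-col8 1 = refl
∑-lowBit-col8 2 = refl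
∑-lowBit-col8 3 = refl
∑-lowBit-col8 4 = refl
∑-lowBit-col8 5 = refl
∑-lowBit-col8 6 = refl
∑-lowBit-col8 7 = refl
∑-lowBit-col8 (suc (suc (suc (suc (suc (suc (suc (suc j)))))))) = ∑-lowBit-col8 j

module Side16q (k : ℕ) where

  q m N M : ℕ
  q = suc k
  m = q * 8
  N = q * 16
  M = q * 32

  high : ℕ → ℕ → ℕ
  high i j = i + j + m * corner i j

  code : ℕ → ℕ → ℕ
  code i j = 2 * high i j + lowBit i j

  entry : Fin N × Fin N → Zsum m M
  entry (i , j) = ⌊ toℕ i /2⌋ mod m , code (toℕ i) (toℕ j) mod M

  μ : Zsum m M
  μ = 0 mod m , (m + N) mod M

  N≡2*m : N ≡ 2 * m
  N≡2*m = eq q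
    where
    eq : ∀ q → q * 16 ≡ 2 * (q * 8)
    eq = solve-∀

  M≡2*N : M ≡ 2 * N
  M≡2*N = eq q
    where
    eq : ∀ q → q * 32 ≡ 2 * (q * 16)
    eq = solve-∀

  2∣N : 2 ∣ N
  2∣N = divides m (trans N≡2*m (*-comm 2 m))

  N≡[q*2]*8 : N ≡ q * 2 * 8
  N≡[q*2]*8 = eq q
    where
    eq : ∀ q → q * 16 ≡ q * 2 * 8
    eq = solve-∀

  8∣N : 8 ∣ N
  8∣N = divides (q * 2) N≡[q*2]*8

  m*c≡[q*c]*8 : ∀ c → m * c ≡ q * c * 8
  m*c≡[q*c]*8 c = eq q c
    where
    eq : ∀ q c → q * 8 * c ≡ q * c * 8
    eq = solve-∀

  ∑-period8 : ∀ f → (∀ x → f (8 + x) ≡ f x) → ∑[ i < 8 ] f i ≡ 4 → ∑ N f ≡ m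
  ∑-period8 f f-per f8 = begin
    ∑ N f               ≡⟨ cong (λ n → ∑ n f) N≡[q*2]*8 ⟩
    ∑ (q * 2 * 8) f     ≡⟨ ∑-periodic 8 (q * 2) f f-per ⟩
    q * 2 * ∑ 8 f       ≡⟨ cong (q * 2 *_) f8 ⟩
    q * 2 * 4           ≡⟨ q*2*4≡m q ⟩
    m                   ∎
    where
    open ≡-Reasoning
    q*2*4≡m : ∀ q → q * 2 * 4 ≡ q * 8
    q*2*4≡m = solve-∀

  ∑-id+m≡N*m : ∑[ i < N ] i + m ≡ N * m
  ∑-id+m≡N*m = *-cancelˡ-≡ _ _ 2 (begin
    2 * (S + m)     ≡⟨ double q S ⟩
    2 * S + N       ≡⟨ 2*∑-id+n≡n*n N ⟩
    N * N           ≡⟨ square q ⟩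
    2 * (N * m)     ∎)
    where
    open ≡-Reasoning
    S = ∑[ i < N ] i
    double : ∀ q S → 2 * (S + q * 8) ≡ 2 * S + q * 16
    double = solve-∀
    square : ∀ q → q * 16 * (q * 16) ≡ 2 * (q * 16 * (q * 8))
    square = solve-∀

  ∑-high : ∀ n (r c : ℕ → ℕ) →
        ∑[ i < n ] high (r i) (c i) ≡ ∑[ i < n ] (r i + c i) + m * ∑[ i < n ] corner (r i) (c i)
  ∑-high n r c = trans (∑-+ n (λ i → r i + c i) (λ i → m * corner (r i) (c i)))
                    (cong (∑[ i < n ] (r i + c i) +_) (∑-*ˡ n m (λ i → corner (r i) (c i))))

  -- The hypothesis is S ≡ m (mod N) stated without subtraction, as N = 2m.
  [2S+m]%M : ∀ S κ → S + m ≡ κ * N → (2 * S + m) % M ≡ (m + N) % M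
  [2S+m]%M S κ S+m≡κN = begin
    (2 * S + m) % M                    ≡⟨ [m+n]%n≡m%n (2 * S + m) M ⟨
    (2 * S + m + M) % M                ≡⟨ cong (_% M) (regroup q S) ⟩
    (2 * (S + m) + (m + N)) % M        ≡⟨ cong (λ x → (2 * x + (m + N)) % M) S+m≡κN ⟩
    (2 * (κ * N) + (m + N)) % M        ≡⟨ cong (_% M) (regroup′ q κ) ⟩
    (m + N + κ * M) % M                ≡⟨ [m+kn]%n≡m%n (m + N) κ M ⟩
    (m + N) % M                        ∎
    where
    open ≡-Reasoning
    regroup : ∀ q S → 2 * S + q * 8 + q * 32 ≡ 2 * (S + q * 8) + (q * 8 + q * 16)
    regroup = solve-∀
    regroup′ : ∀ q κ → 2 * (κ * (q * 16)) + (q * 8 + q * 16) ≡ q * 8 + q * 16 + κ * (q * 32)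
    regroup′ = solve-∀

  line-sum : (cell : Fin N → Fin N × Fin N) (r c : ℕ → ℕ) →
             (∀ i → toℕ (proj₁ (cell i)) ≡ r (toℕ i)) →
             (∀ i → toℕ (proj₂ (cell i)) ≡ c (toℕ i)) →
             ∑[ i < N ] ⌊ r i /2⌋ % m ≡ 0 →
             ∑[ i < N ] lowBit (r i) (c i) ≡ m →
             (κ : ℕ) → ∑[ i < N ] high (r i) (c i) + m ≡ κ * N →
             sumZ m M N (λ i → entry (cell i)) ≡ μ
  line-sum cell r c cell₁≡r cell₂≡c ∑half ∑lowBit κ ∑high = begin
    sumZ m M N (λ i → entry (cell i))
      ≡⟨ sumZ-cong m M N {λ i → entry (cell i)} {λ i → ⌊ r (toℕ i) /2⌋ mod m , code (r (toℕ i)) (c (toℕ i)) mod M}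
           (λ i → cong₂ (λ x y → ⌊ x /2⌋ mod m , code x y mod M) (cell₁≡r i) (cell₂≡c i)) ⟩
    sumZ m M N (λ i → ⌊ r (toℕ i) /2⌋ mod m , code (r (toℕ i)) (c (toℕ i)) mod M)
      ≡⟨ sumZ-mod m M N (λ i → ⌊ r i /2⌋) (λ i → code (r i) (c i)) ⟩
    (∑[ i < N ] ⌊ r i /2⌋ mod m , ∑[ i < N ] code (r i) (c i) mod M)
      ≡⟨ cong₂ _,_ (mod-cong (∑[ i < N ] ⌊ r i /2⌋) 0 m ∑half)
                   (mod-cong (∑[ i < N ] code (r i) (c i)) (m + N) M ∑code) ⟩
    μ ∎
    where
    open ≡-Reasoning
    ∑code : ∑[ i < N ] code (r i) (c i) % M ≡ (m + N) % M
    ∑code = begin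
      ∑[ i < N ] code (r i) (c i) % M
        ≡⟨ cong (_% M) (∑-+ N (λ i → 2 * high (r i) (c i)) (λ i → lowBit (r i) (c i))) ⟩
      (∑[ i < N ] (2 * high (r i) (c i)) + ∑[ i < N ] lowBit (r i) (c i)) % M
        ≡⟨ cong₂ (λ x y → (x + y) % M) (∑-*ˡ N 2 (λ i → high (r i) (c i))) ∑lowBit ⟩
      (2 * ∑[ i < N ] high (r i) (c i) + m) % M
        ≡⟨ [2S+m]%M (∑[ i < N ] high (r i) (c i)) κ ∑high ⟩
      (m + N) % M ∎

  ∑-⌊i/2⌋%m : ∑[ i < N ] ⌊ i /2⌋ % m ≡ 0
  ∑-⌊i/2⌋%m = begin
    S % m                ≡⟨ [m+n]%n≡m%n S m ⟨
    (S + m) % m          ≡⟨ cong (_% m) (trans (cong (λ n → ∑[ i < n ] ⌊ i /2⌋ + m) (N≡m*2 q)) (∑-⌊/2⌋+n≡n*n m)) ⟩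
    (m * m) % m          ≡⟨ m*n%n≡0 m m ⟩
    0                    ∎
    where
    open ≡-Reasoning
    S = ∑[ i < N ] ⌊ i /2⌋
    N≡m*2 : ∀ q → q * 16 ≡ q * 8 * 2
    N≡m*2 = solve-∀

  ∑-const%m : ∀ c → ∑[ _ < N ] c % m ≡ 0
  ∑-const%m c = trans (cong (_% m) (trans (∑-const N c) (N*c≡[2*c]*m q c))) (m*n%n≡0 (2 * c) m)
    where
    N*c≡[2*c]*m : ∀ q c → q * 16 * c ≡ 2 * c * (q * 8)
    N*c≡[2*c]*m = solve-∀

  ∑-lowBit-row : ∀ i → ∑[ j < N ] lowBit i j ≡ m
  ∑-lowBit-row i = ∑-period8 (lowBit i) (λ j → cong (λ b → (i + bit₂ b) % 2) (shift i j)) (∑-lowBit-row8 i)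
    where
    shift : ∀ i j → i + (8 + j) ≡ 8 + (i + j)
    shift = solve-∀

  ∑-lowBit-col : ∀ j → ∑[ i < N ] lowBit i j ≡ m
  ∑-lowBit-col j = ∑-period8 (λ i → lowBit i j) (λ _ → refl) (∑-lowBit-col8 j)

  ∑-lowBit-diag : ∑[ i < N ] lowBit i i ≡ m
  ∑-lowBit-diag = ∑-period8 (λ i → lowBit i i) (λ i → cong (λ b → (8 + i + bit₂ b) % 2) (shift i)) refl
    where
    shift : ∀ i → 8 + i + (8 + i) ≡ 16 + (i + i)
    shift = solve-∀

  i+[N∸suc[i]]≡N∸1 : ∀ i → i < N → i + (N ∸ suc i) ≡ N ∸ 1
  i+[N∸suc[i]]≡N∸1 i i<N = suc-injective (m+[n∸m]≡n i<N)

  ∑-lowBit-anti : ∑[ i < N ] lowBit i (N ∸ suc i) ≡ m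
  ∑-lowBit-anti = trans (∑-cong N onAnti) (∑-period8 (λ i → (i + 1) % 2) (λ _ → refl) refl)
    where
    15+16k≡15+[2k]*8 : ∀ k → 15 + k * 16 ≡ 15 + k * 2 * 8
    15+16k≡15+[2k]*8 = solve-∀
    bit₂[N∸1]≡1 : bit₂ (N ∸ 1) ≡ 1
    bit₂[N∸1]≡1 = trans (cong bit₂ (15+16k≡15+[2k]*8 k)) (bit₂[m+n*8]≡bit₂m 15 (k * 2))
    onAnti : ∀ i → i < N → lowBit i (N ∸ suc i) ≡ (i + 1) % 2
    onAnti i i<N = trans (cong (λ b → (i + bit₂ b) % 2) (i+[N∸suc[i]]≡N∸1 i i<N))
                         (cong (λ b → (i + b) % 2) bit₂[N∸1]≡1)

  ∑-high-row : ∀ i → ∑[ j < N ] high i j + m ≡ (i + m + below2 i * (q * 4)) * N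
  ∑-high-row i = begin
    ∑[ j < N ] high i j + m
      ≡⟨ cong (_+ m) (∑-high N (λ _ → i) (λ j → j)) ⟩
    ∑[ j < N ] (i + j) + m * ∑[ j < N ] corner i j + m
      ≡⟨ cong₂ (λ x y → x + m * y + m) (trans (∑-+ N (λ _ → i) (λ j → j)) (cong (_+ S) (∑-const N i)))
                                       (trans (∑-*ˡ N (below2 i) isEven) (cong (below2 i *_) ∑-isEven)) ⟩
    N * i + S + m * (below2 i * m) + m
      ≡⟨ regroup (N * i) S (m * (below2 i * m)) m ⟩
    N * i + m * (below2 i * m) + (S + m)
      ≡⟨ cong (N * i + m * (below2 i * m) +_) ∑-id+m≡N*m ⟩
    N * i + m * (below2 i * m) + N * m
      ≡⟨ factor q i (below2 i) ⟩
    (i + m + below2 i * (q * 4)) * N ∎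
    where
    open ≡-Reasoning
    S = ∑[ j < N ] j
    ∑-isEven : ∑[ j < N ] isEven j ≡ m
    ∑-isEven = ∑-period8 isEven (λ _ → refl) refl
    regroup : ∀ a S b m → a + S + b + m ≡ a + b + (S + m)
    regroup = solve-∀
    factor : ∀ q i h → q * 16 * i + q * 8 * (h * (q * 8)) + q * 16 * (q * 8) ≡ (i + q * 8 + h * (q * 4)) * (q * 16)
    factor = solve-∀

  ∑-high-col : ∀ j → ∑[ i < N ] high i j + m ≡ (m + j + isEven j) * N
  ∑-high-col j = begin
    ∑[ i < N ] high i j + m
      ≡⟨ cong (_+ m) (∑-high N (λ i → i) (λ _ → j)) ⟩
    ∑[ i < N ] (i + j) + m * ∑[ i < N ] corner i j + m
      ≡⟨ cong₂ (λ x y → x + m * y + m) (trans (∑-+ N (λ i → i) (λ _ → j)) (cong (S +_) (∑-const N j)))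
                                       (∑-below2 (14 + k * 16) (λ _ → isEven j)) ⟩
    S + N * j + m * (isEven j + isEven j) + m
      ≡⟨ regroup S (N * j) (m * (isEven j + isEven j)) m ⟩
    (S + m) + N * j + m * (isEven j + isEven j)
      ≡⟨ cong (λ x → x + N * j + m * (isEven j + isEven j)) ∑-id+m≡N*m ⟩
    N * m + N * j + m * (isEven j + isEven j)
      ≡⟨ factor q j (isEven j) ⟩
    (m + j + isEven j) * N ∎
    where
    open ≡-Reasoning
    S = ∑[ i < N ] i
    regroup : ∀ S a b m → S + a + b + m ≡ (S + m) + a + b
    regroup = solve-∀
    factor : ∀ q j e → q * 16 * (q * 8) + q * 16 * j + q * 8 * (e + e) ≡ (q * 8 + j + e) * (q * 16)
    factor = solve-∀

  ∑-high-diag : ∑[ i < N ] high i i + m ≡ N * N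
  ∑-high-diag = begin
    ∑[ i < N ] high i i + m
      ≡⟨ cong (_+ m) (∑-high N (λ i → i) (λ i → i)) ⟩
    ∑[ i < N ] (i + i) + m * ∑[ i < N ] corner i i + m
      ≡⟨ cong₂ (λ x y → x + m * y + m) (∑-+ N (λ i → i) (λ i → i)) (∑-below2 (14 + k * 16) isEven) ⟩
    S + S + m * 1 + m
      ≡⟨ regroup S m ⟩
    (S + m) + (S + m)
      ≡⟨ cong (λ x → x + x) ∑-id+m≡N*m ⟩
    N * m + N * m
      ≡⟨ factor q ⟩
    N * N ∎
    where
    open ≡-Reasoning
    S = ∑[ i < N ] i
    regroup : ∀ S m → S + S + m * 1 + m ≡ (S + m) + (S + m)
    regroup = solve-∀
    factor : ∀ q → q * 16 * (q * 8) + q * 16 * (q * 8) ≡ q * 16 * (q * 16)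
    factor = solve-∀

  ∑-high-anti : ∑[ i < N ] high i (N ∸ suc i) + m ≡ N * N
  ∑-high-anti = begin
    ∑[ i < N ] high i (N ∸ suc i) + m
      ≡⟨ cong (_+ m) (∑-high N (λ i → i) (λ i → N ∸ suc i)) ⟩
    ∑[ i < N ] (i + (N ∸ suc i)) + m * ∑[ i < N ] corner i (N ∸ suc i) + m
      ≡⟨ cong₂ (λ x y → x + m * y + m) (trans (∑-cong N i+[N∸suc[i]]≡N∸1) (∑-const N (N ∸ 1)))
                                       (trans (∑-below2 (14 + k * 16) (λ i → isEven (N ∸ suc i))) corners) ⟩
    N * (N ∸ 1) + m * 1 + m
      ≡⟨ factor k ⟩
    N * N ∎
    where
    open ≡-Reasoning
    [m+n*16]%2≡m%2 : ∀ m n → (m + n * 16) % 2 ≡ m % 2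
    [m+n*16]%2≡m%2 m n = trans (cong (λ x → (m + x) % 2) (n*16≡n*8*2 n)) ([m+kn]%n≡m%n m (n * 8) 2)
      where
      n*16≡n*8*2 : ∀ n → n * 16 ≡ n * 8 * 2
      n*16≡n*8*2 = solve-∀
    corners : isEven (N ∸ 1) + isEven (N ∸ 2) ≡ 1
    corners = cong₂ (λ x y → 1 ∸ x + (1 ∸ y)) ([m+n*16]%2≡m%2 15 k) ([m+n*16]%2≡m%2 14 k)
    factor : ∀ k → (16 + k * 16) * (15 + k * 16) + (8 + k * 8) * 1 + (8 + k * 8) ≡ (16 + k * 16) * (16 + k * 16)
    factor = solve-∀

  rows : ∀ i → sumZ m M N (λ j → entry (i , j)) ≡ μ
  rows i = line-sum (λ j → i , j) (λ _ → toℕ i) (λ j → j) (λ _ → refl) (λ _ → refl)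
             (∑-const%m ⌊ toℕ i /2⌋) (∑-lowBit-row (toℕ i)) (toℕ i + m + below2 (toℕ i) * (q * 4)) (∑-high-row (toℕ i))

  cols : ∀ j → sumZ m M N (λ i → entry (i , j)) ≡ μ
  cols j = line-sum (λ i → i , j) (λ i → i) (λ _ → toℕ j) (λ _ → refl) (λ _ → refl)
             ∑-⌊i/2⌋%m (∑-lowBit-col (toℕ j)) (m + toℕ j + isEven (toℕ j)) (∑-high-col (toℕ j))

  diag : sumZ m M N (λ i → entry (i , i)) ≡ μ
  diag = line-sum (λ i → i , i) (λ i → i) (λ i → i) (λ _ → refl) (λ _ → refl)
           ∑-⌊i/2⌋%m ∑-lowBit-diag N ∑-high-diag

  antidiag : sumZ m M N (λ i → entry (i , opp i)) ≡ μ
  antidiag = line-sum (λ i → i , opp i) (λ i → i) (λ i → N ∸ suc i) (λ _ → refl) opposite-prop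
               ∑-⌊i/2⌋%m ∑-lowBit-anti N ∑-high-anti

  [2x+e]%M≡2[x%N]+e : ∀ x e → e ≤ 1 → (2 * x + e) % M ≡ 2 * (x % N) + e
  [2x+e]%M≡2[x%N]+e x e e≤1 = begin
    (2 * x + e) % M                          ≡⟨ cong (λ y → (2 * y + e) % M) (m≡m%n+[m/n]*n x N) ⟩
    (2 * (x % N + x / N * N) + e) % M        ≡⟨ cong (_% M) (regroup q (x % N) (x / N) e) ⟩
    (2 * (x % N) + e + x / N * M) % M        ≡⟨ [m+kn]%n≡m%n (2 * (x % N) + e) (x / N) M ⟩
    (2 * (x % N) + e) % M                    ≡⟨ m<n⇒m%n≡m (subst (2 * (x % N) + e <_) (sym M≡2*N) (2m+n<2o (m%n<n x N) e≤1)) ⟩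
    2 * (x % N) + e                          ∎
    where
    open ≡-Reasoning
    regroup : ∀ q r d e → 2 * (r + d * (q * 16)) + e ≡ 2 * r + e + d * (q * 32)
    regroup = solve-∀

  code%M : ∀ i j → code i j % M ≡ 2 * (high i j % N) + lowBit i j
  code%M i j = [2x+e]%M≡2[x%N]+e (high i j) (lowBit i j) (n%2≤1 (i + bit₂ (i + j)))

  ⌊code%M/2⌋ : ∀ i j → ⌊ code i j % M /2⌋ ≡ high i j % N
  ⌊code%M/2⌋ i j = trans (cong ⌊_/2⌋ (code%M i j)) (⌊2m+n/2⌋≡m (high i j % N) (n%2≤1 (i + bit₂ (i + j))))

  code%M%2 : ∀ i j → code i j % M % 2 ≡ lowBit i j
  code%M%2 i j = trans (cong (_% 2) (code%M i j))
                       (trans ([2m+n]%2≡n%2 (high i j % N) (lowBit i j)) (m%n%n≡m%n (i + bit₂ (i + j)) 2))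

  bit₂[high%N] : ∀ i j → bit₂ (high i j % N) ≡ bit₂ (i + j)
  bit₂[high%N] i j = begin
    bit₂ (high i j % N)                 ≡⟨ bit₂[m%n]≡bit₂m (high i j) N 8∣N ⟩
    bit₂ (i + j + m * corner i j)       ≡⟨ cong (λ x → bit₂ (i + j + x)) (m*c≡[q*c]*8 (corner i j)) ⟩
    bit₂ (i + j + q * corner i j * 8)   ≡⟨ bit₂[m+n*8]≡bit₂m (i + j) (q * corner i j) ⟩
    bit₂ (i + j)                        ∎
    where open ≡-Reasoning

  isEven[high%N+i] : ∀ i j → isEven (high i j % N + i) ≡ isEven j
  isEven[high%N+i] i j = cong (1 ∸_) (begin
    (high i j % N + i) % 2                    ≡⟨ [m%n+o]%2≡[m+o]%2 (high i j) N i 2∣N ⟩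
    (high i j + i) % 2                        ≡⟨ cong (_% 2) (regroup q i j (corner i j)) ⟩
    (2 * (i + q * 4 * corner i j) + j) % 2    ≡⟨ [2m+n]%2≡n%2 (i + q * 4 * corner i j) j ⟩
    j % 2                                     ∎)
    where
    open ≡-Reasoning
    regroup : ∀ q i j c → i + j + q * 8 * c + i ≡ 2 * (i + q * 4 * c) + j
    regroup = solve-∀

  x+N+2mc≡x+[1+c]N : ∀ x c → x + N + 2 * m * c ≡ x + (1 + c) * N
  x+N+2mc≡x+[1+c]N x c = eq q x c
    where
    eq : ∀ q x c → x + q * 16 + 2 * (q * 8) * c ≡ x + (1 + c) * (q * 16)
    eq = solve-∀

  row : ℕ → ℕ → ℕ
  row a b = 2 * a + (b % 2 + bit₂ ⌊ b /2⌋) % 2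

  -- Subtracting m·corner modulo N is adding it, as N = 2m.
  col : ℕ → ℕ → ℕ
  col i b = ⌊ b /2⌋ + m * corner i (⌊ b /2⌋ + i) + (N ∸ i)

  row-code : ∀ i j → row ⌊ i /2⌋ (code i j % M) ≡ i
  row-code i j = begin
    2 * ⌊ i /2⌋ + (code i j % M % 2 + bit₂ ⌊ code i j % M /2⌋) % 2
      ≡⟨ cong₂ (λ e s → 2 * ⌊ i /2⌋ + (e + bit₂ s) % 2) (code%M%2 i j) (⌊code%M/2⌋ i j) ⟩
    2 * ⌊ i /2⌋ + (lowBit i j + bit₂ (high i j % N)) % 2
      ≡⟨ cong (λ t → 2 * ⌊ i /2⌋ + (lowBit i j + t) % 2) (bit₂[high%N] i j) ⟩
    2 * ⌊ i /2⌋ + ((i + bit₂ (i + j)) % 2 + bit₂ (i + j)) % 2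
      ≡⟨ cong (2 * ⌊ i /2⌋ +_) ([[m+n]%2+n]%2≡m%2 i (bit₂ (i + j))) ⟩
    2 * ⌊ i /2⌋ + i % 2
      ≡⟨ 2*⌊n/2⌋+n%2≡n i ⟩
    i ∎
    where open ≡-Reasoning

  col-code : ∀ i j → i < N → j < N → col i (code i j % M) % N ≡ j
  col-code i j i<N j<N = begin
    col i (code i j % M) % N
      ≡⟨ cong (λ s → (s + m * corner i (s + i) + (N ∸ i)) % N) (⌊code%M/2⌋ i j) ⟩
    (high i j % N + m * corner i (high i j % N + i) + (N ∸ i)) % N
      ≡⟨ cong (λ e → (high i j % N + m * (below2 i * e) + (N ∸ i)) % N) (isEven[high%N+i] i j) ⟩
    (high i j % N + m * c + (N ∸ i)) % N
      ≡⟨ cong (_% N) (+-assoc (high i j % N) (m * c) (N ∸ i)) ⟩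
    (high i j % N + (m * c + (N ∸ i))) % N
      ≡⟨ [m%n+o]%n≡[m+o]%n (high i j) (m * c + (N ∸ i)) N ⟩
    (high i j + (m * c + (N ∸ i))) % N
      ≡⟨ cong (_% N) (regroup q i j c (N ∸ i)) ⟩
    (j + (i + (N ∸ i)) + 2 * m * c) % N
      ≡⟨ cong (λ t → (j + t + 2 * m * c) % N) (m+[n∸m]≡n (<⇒≤ i<N)) ⟩
    (j + N + 2 * m * c) % N
      ≡⟨ cong (_% N) (x+N+2mc≡x+[1+c]N j c) ⟩
    (j + (1 + c) * N) % N
      ≡⟨ [m+kn]%n≡m%n j (1 + c) N ⟩
    j % N
      ≡⟨ m<n⇒m%n≡m j<N ⟩
    j ∎
    where
    open ≡-Reasoning
    c = corner i j
    regroup : ∀ q i j c t → i + j + q * 8 * c + (q * 8 * c + t) ≡ j + (i + t) + 2 * (q * 8) * c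
    regroup = solve-∀

  row<N : ∀ {a} b → a < m → row a b < N
  row<N {a} b a<m = subst (row a b <_) (sym N≡2*m) (2m+n<2o a<m (n%2≤1 (b % 2 + bit₂ ⌊ b /2⌋)))

  ⌊row/2⌋≡a : ∀ a b → ⌊ row a b /2⌋ ≡ a
  ⌊row/2⌋≡a a b = ⌊2m+n/2⌋≡m a (n%2≤1 (b % 2 + bit₂ ⌊ b /2⌋))

  module _ {a b : ℕ} (a<m : a < m) (b<M : b < M) where
    private
      i s y c : ℕ
      i = row a b
      s = ⌊ b /2⌋
      y = col i b
      c = corner i (s + i)

      i+[N∸i]≡N : i + (N ∸ i) ≡ N
      i+[N∸i]≡N = m+[n∸m]≡n (<⇒≤ (row<N b a<m))

    corner-col : corner i (y % N) ≡ c
    corner-col = cong (λ e → below2 i * (1 ∸ e)) (begin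
      y % N % 2                                    ≡⟨ m∣n⇒o%n%m≡o%m 2 N y 2∣N ⟩
      y % 2                                        ≡⟨ [2m+n]%2≡n%2 i y ⟨
      (2 * i + y) % 2                              ≡⟨ cong (_% 2) (regroup q s i c (N ∸ i)) ⟩
      (2 * (q * 4 * c) + (s + i + (i + (N ∸ i)))) % 2
        ≡⟨ cong (λ t → (2 * (q * 4 * c) + (s + i + t)) % 2) i+[N∸i]≡N ⟩
      (2 * (q * 4 * c) + (s + i + N)) % 2          ≡⟨ cong (_% 2) (regroup′ q s i c) ⟩
      (2 * (q * 4 * c + q * 8) + (s + i)) % 2      ≡⟨ [2m+n]%2≡n%2 (q * 4 * c + q * 8) (s + i) ⟩
      (s + i) % 2                                  ∎)
      where
      open ≡-Reasoning
      regroup : ∀ q s i c t → 2 * i + (s + q * 8 * c + t) ≡ 2 * (q * 4 * c) + (s + i + (i + t))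
      regroup = solve-∀
      regroup′ : ∀ q s i c → 2 * (q * 4 * c) + (s + i + q * 16) ≡ 2 * (q * 4 * c + q * 8) + (s + i)
      regroup′ = solve-∀

    high[col]%N : high i (y % N) % N ≡ s
    high[col]%N = begin
      (i + y % N + m * corner i (y % N)) % N   ≡⟨ cong (λ h → (i + y % N + m * h) % N) corner-col ⟩
      (i + y % N + m * c) % N                  ≡⟨ cong (_% N) (swap i (y % N) (m * c)) ⟩
      (y % N + (i + m * c)) % N                ≡⟨ [m%n+o]%n≡[m+o]%n y (i + m * c) N ⟩
      (y + (i + m * c)) % N                    ≡⟨ cong (_% N) (regroup q s i c (N ∸ i)) ⟩
      (s + (i + (N ∸ i)) + 2 * m * c) % N      ≡⟨ cong (λ t → (s + t + 2 * m * c) % N) i+[N∸i]≡N ⟩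
      (s + N + 2 * m * c) % N                  ≡⟨ cong (_% N) (x+N+2mc≡x+[1+c]N s c) ⟩
      (s + (1 + c) * N) % N                    ≡⟨ [m+kn]%n≡m%n s (1 + c) N ⟩
      s % N                                    ≡⟨ m<n⇒m%n≡m (⌊n/2⌋<m (subst (b <_) M≡2*N b<M)) ⟩
      s                                        ∎
      where
      open ≡-Reasoning
      swap : ∀ x y z → x + y + z ≡ y + (x + z)
      swap = solve-∀
      regroup : ∀ q s i c t → s + q * 8 * c + t + (i + q * 8 * c) ≡ s + (i + t) + 2 * (q * 8) * c
      regroup = solve-∀

    lowBit-col : lowBit i (y % N) ≡ b % 2
    lowBit-col = begin
      (i + bit₂ (i + y % N)) % 2               ≡⟨ cong (λ t → (i + t) % 2) (bit₂[high%N] i (y % N)) ⟨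
      (i + bit₂ (high i (y % N) % N)) % 2      ≡⟨ cong (λ t → (i + bit₂ t) % 2) high[col]%N ⟩
      (2 * a + e + bit₂ s) % 2                 ≡⟨ cong (_% 2) (+-assoc (2 * a) e (bit₂ s)) ⟩
      (2 * a + (e + bit₂ s)) % 2               ≡⟨ [2m+n]%2≡n%2 a (e + bit₂ s) ⟩
      ((b % 2 + bit₂ s) % 2 + bit₂ s) % 2      ≡⟨ [[m+n]%2+n]%2≡m%2 (b % 2) (bit₂ s) ⟩
      b % 2 % 2                                ≡⟨ m%n%n≡m%n b 2 ⟩
      b % 2                                    ∎
      where
      open ≡-Reasoning
      e = (b % 2 + bit₂ s) % 2

    code-col : code i (y % N) % M ≡ b
    code-col = begin
      code i (y % N) % M                           ≡⟨ code%M i (y % N) ⟩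
      2 * (high i (y % N) % N) + lowBit i (y % N)  ≡⟨ cong₂ (λ x e → 2 * x + e) high[col]%N lowBit-col ⟩
      2 * ⌊ b /2⌋ + b % 2                          ≡⟨ 2*⌊n/2⌋+n%2≡n b ⟩
      b                                            ∎
      where open ≡-Reasoning

  decode : Zsum m M → Fin N × Fin N
  decode (a , b) = fromℕ< (row<N (toℕ b) (toℕ<n a)) , col (row (toℕ a) (toℕ b)) (toℕ b) mod N

  decode-entry : ∀ c → decode (entry c) ≡ c
  decode-entry (i , j) = cong₂ _,_ (toℕ-injective (trans (toℕ-fromℕ< (row<N b (toℕ<n a))) row≡i))
                                   (toℕ-injective (trans (toℕ-mod (col (row (toℕ a) b) b) N) col≡j))
    where
    a = ⌊ toℕ i /2⌋ mod m
    b = toℕ (code (toℕ i) (toℕ j) mod M)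
    a≡ : toℕ a ≡ ⌊ toℕ i /2⌋
    a≡ = trans (toℕ-mod ⌊ toℕ i /2⌋ m) (m<n⇒m%n≡m (⌊n/2⌋<m (subst (toℕ i <_) N≡2*m (toℕ<n i))))
    b≡ : b ≡ code (toℕ i) (toℕ j) % M
    b≡ = toℕ-mod (code (toℕ i) (toℕ j)) M
    row≡i : row (toℕ a) b ≡ toℕ i
    row≡i = trans (cong₂ row a≡ b≡) (row-code (toℕ i) (toℕ j))
    col≡j : col (row (toℕ a) b) b % N ≡ toℕ j
    col≡j = trans (cong₂ (λ r b → col r b % N) row≡i b≡) (col-code (toℕ i) (toℕ j) (toℕ<n i) (toℕ<n j))

  entry-decode : ∀ g → entry (decode g) ≡ g
  entry-decode (a , b) = cong₂ _,_ (toℕ-injective first) (toℕ-injective second)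
    where
    a<m = toℕ<n a
    i = fromℕ< (row<N (toℕ b) a<m)
    y = col (row (toℕ a) (toℕ b)) (toℕ b)
    i≡ : toℕ i ≡ row (toℕ a) (toℕ b)
    i≡ = toℕ-fromℕ< (row<N (toℕ b) a<m)
    first : toℕ (⌊ toℕ i /2⌋ mod m) ≡ toℕ a
    first = begin
      toℕ (⌊ toℕ i /2⌋ mod m)          ≡⟨ toℕ-mod ⌊ toℕ i /2⌋ m ⟩
      ⌊ toℕ i /2⌋ % m                  ≡⟨ cong (λ r → ⌊ r /2⌋ % m) i≡ ⟩
      ⌊ row (toℕ a) (toℕ b) /2⌋ % m    ≡⟨ cong (_% m) (⌊row/2⌋≡a (toℕ a) (toℕ b)) ⟩
      toℕ a % m                        ≡⟨ m<n⇒m%n≡m a<m ⟩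
      toℕ a                            ∎
      where open ≡-Reasoning
    second : toℕ (code (toℕ i) (toℕ (y mod N)) mod M) ≡ toℕ b
    second = trans (toℕ-mod (code (toℕ i) (toℕ (y mod N))) M)
                   (trans (cong₂ (λ r j → code r j % M) i≡ (toℕ-mod y N)) (code-col a<m (toℕ<n b)))

  magicSquare : MagicSquare m M N
  magicSquare = record
    { entry     = entry
    ; bijective = inverseᵇ⇒bijective (strictlyInverseˡ⇒inverseˡ {f⁻¹ = decode} entry entry-decode ,
                                      strictlyInverseʳ⇒inverseʳ {f⁻¹ = decode} entry decode-entry)
    ; μ         = μ
    ; rows      = rows
    ; cols      = cols
    ; diag      = diag
    ; antidiag  = antidiag
    }

module Side4 where

  _≟_ : ∀ {a b} → DecidableEquality (Fin a × Fin b)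
  _≟_ = ≡-dec _≟ᶠ_ _≟ᶠ_

  table : Vec (Vec (Fin 2 × Fin 8) 4) 4
  table = ((# 0 , # 0) ∷ (# 0 , # 1) ∷ (# 0 , # 2) ∷ (# 0 , # 5) ∷ [])
        ∷ ((# 0 , # 3) ∷ (# 1 , # 0) ∷ (# 0 , # 7) ∷ (# 1 , # 6) ∷ [])
        ∷ ((# 1 , # 4) ∷ (# 1 , # 3) ∷ (# 1 , # 2) ∷ (# 1 , # 7) ∷ [])
        ∷ ((# 1 , # 1) ∷ (# 0 , # 4) ∷ (# 1 , # 5) ∷ (# 0 , # 6) ∷ [])
        ∷ []

  inverseTable : Vec (Vec (Fin 4 × Fin 4) 8) 2
  inverseTable = ((# 0 , # 0) ∷ (# 0 , # 1) ∷ (# 0 , # 2) ∷ (# 1 , # 0)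
                  ∷ (# 3 , # 1) ∷ (# 0 , # 3) ∷ (# 3 , # 3) ∷ (# 1 , # 2) ∷ [])
               ∷ ((# 1 , # 1) ∷ (# 3 , # 0) ∷ (# 2 , # 2) ∷ (# 2 , # 1)
                  ∷ (# 2 , # 0) ∷ (# 3 , # 2) ∷ (# 1 , # 3) ∷ (# 2 , # 3) ∷ [])
               ∷ []

  entry : Fin 4 × Fin 4 → Fin 2 × Fin 8
  entry (i , j) = lookup (lookup table i) j

  decode : Fin 2 × Fin 8 → Fin 4 × Fin 4
  decode (a , b) = lookup (lookup inverseTable a) b

  μ : Fin 2 × Fin 8
  μ = # 0 , # 0

  decode-entry : ∀ c → decode (entry c) ≡ c
  decode-entry (i , j) = from-yes (all? λ i → all? λ j → decode (entry (i , j)) ≟ (i , j)) i j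

  entry-decode : ∀ g → entry (decode g) ≡ g
  entry-decode (a , b) = from-yes (all? λ a → all? λ b → entry (decode (a , b)) ≟ (a , b)) a b

  magicSquare : MagicSquare 2 8 4
  magicSquare = record
    { entry     = entry
    ; bijective = inverseᵇ⇒bijective (strictlyInverseˡ⇒inverseˡ {f⁻¹ = decode} entry entry-decode ,
                                      strictlyInverseʳ⇒inverseʳ {f⁻¹ = decode} entry decode-entry)
    ; μ         = μ
    ; rows      = from-yes (all? λ i → sumZ 2 8 4 (λ j → entry (i , j)) ≟ μ)
    ; cols      = from-yes (all? λ j → sumZ 2 8 4 (λ i → entry (i , j)) ≟ μ)
    ; diag      = refl
    ; antidiag  = refl
    }

MagicSquare-cong : ∀ {a a′ b b′ n n′} .{{_ : NonZero a′}} .{{_ : NonZero b′}} .{{_ : NonZero a}} .{{_ : NonZero b}} →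
                   a ≡ a′ → b ≡ b′ → n ≡ n′ → MagicSquare a b n → MagicSquare a′ b′ n′
MagicSquare-cong refl refl refl S = S

2^[2[1+d]+c]≡4^d*[2^c*4] : ∀ d c → 2 ^ (2 * suc d + c) ≡ 4 ^ d * (2 ^ c * 4)
2^[2[1+d]+c]≡4^d*[2^c*4] d c = begin
  2 ^ (2 * suc d + c)       ≡⟨ ^-distribˡ-+-* 2 (2 * suc d) c ⟩
  2 ^ (2 * suc d) * 2 ^ c   ≡⟨ cong (_* 2 ^ c) (^-*-assoc 2 2 (suc d)) ⟨
  4 * 4 ^ d * 2 ^ c         ≡⟨ regroup (4 ^ d) (2 ^ c) ⟩
  4 ^ d * (2 ^ c * 4)       ∎
  where
  open ≡-Reasoning
  regroup : ∀ x y → 4 * x * y ≡ x * (y * 4)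
  regroup = solve-∀

lemma4p6 : (δ : ℕ) → MagicSquare (2 ^ (2 * δ + 1)) (2 ^ (2 * δ + 3)) {{m^n≢0 2 (2 * δ + 1)}} {{m^n≢0 2 (2 * δ + 3)}} (2 ^ (2 * δ + 2))
lemma4p6 zero = Side4.magicSquare
lemma4p6 (suc δ) with 4 ^ δ in 4^δ≡q | m^n>0 4 δ
... | zero  | ()
... | suc k | _  = MagicSquare-cong {{m^n≢0 2 (2 * suc δ + 1)}} {{m^n≢0 2 (2 * suc δ + 3)}}
                     (side 1) (side 3) (side 2) (Side16q.magicSquare k)
  where
  side : ∀ c → suc k * (2 ^ c * 4) ≡ 2 ^ (2 * suc δ + c)
  side c = trans (cong (λ x → x * (2 ^ c * 4)) (sym 4^δ≡q)) (sym (2^[2[1+d]+c]≡4^d*[2^c*4] δ c))
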